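{- Let $S$ be an equivariant system of ideals for a commutative preordered group $G$ such that $U_x(S)=S$ for all $x\in G$. Then $S$ is regular.
   Context: $G$ is an abelian group with a preorder $\leqslant$ such that $a\leqslant b$ implies $a+c\leqslant b+c$. For nonempty finite subsets write $A,B$ for $A\cup B$, $a$ for $\{a\}$, $A\pm x=\{a\pm x:a\in A\}$, $A+B=\{a+b:a\in A,b\in B\}$. An equivariant system of ideals is a predicate $S$ on nonempty finite subsets of $G$ such that: (P1) $S(A)$ if $A\supseteq A'$ and $S(A')$; (P2') $S(A)$ if $S(A,u)$ and $S(A-u)$; (P3) $S(a)$ if $a\leqslant 0$. It is regular if moreover (P2) $S(A+B)$ whenever $S(A+B,A)$ and $S(A+B,B)$, and (P5) $S(x,-x)$ for all $x\in G$. $Q$ contains $S$ if $S(A)$ implies $Q(A)$. $T_x(S)$ is the least equivariant system of ideals $Q$ containing $S$ with $Q(x)$; $U_x(S)=T_x(S)\cap T_{ -x}(S)$ (pointwise conjunction of predicates). -}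

module Defs where

open import Level using (Level; _⊔_; suc)
open import Algebra.Bundles using (AbelianGroup)
open import Relation.Binary.Core using (Rel)
open import Relation.Binary.Structures using (IsPreorder)
open import Data.List.NonEmpty as L⁺ using (List⁺; [_]; _⁺++⁺_; toList)
open import Data.List.Relation.Unary.Any using (Any)
open import Data.Product using (_×_)

record PreorderedAbelianGroup (c ℓ ℓ' : Level) : Set (suc (c ⊔ ℓ ⊔ ℓ')) where
  field
    abGroup : AbelianGroup c ℓ
  open AbelianGroup abGroup public
  field
    _≤_ : Rel Carrier ℓ'
    isPreorder : IsPreorder _≈_ _≤_
    ≤-translate : ∀ a b c → a ≤ b → (a ∙ c) ≤ (b ∙ c)

module Ideals {c ℓ ℓ' : Level} (𝔾 : PreorderedAbelianGroup c ℓ ℓ') where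
  open PreorderedAbelianGroup 𝔾

  -- nonempty finite subsets of G, represented by nonempty lists;
  -- membership is taken up to the group's equality ≈
  FinSub : Set c
  FinSub = List⁺ Carrier

  _∈_ : Carrier → FinSub → Set (c ⊔ ℓ)
  x ∈ A = Any (x ≈_) (toList A)

  _⊇_ : FinSub → FinSub → Set (c ⊔ ℓ)
  A ⊇ A' = ∀ {x} → x ∈ A' → x ∈ A

  _,,_ : FinSub → FinSub → FinSub
  A ,, B = A ⁺++⁺ B

  _+ₛ_ : FinSub → Carrier → FinSub
  A +ₛ x = L⁺.map (λ a → a ∙ x) A

  _-ₛ_ : FinSub → Carrier → FinSub
  A -ₛ x = L⁺.map (λ a → a ∙ (x ⁻¹)) A

  _⊕_ : FinSub → FinSub → FinSub
  A ⊕ B = L⁺.concatMap (λ a → L⁺.map (λ b → a ∙ b) B) A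

  record IsEquivariant {ℓs : Level} (S : FinSub → Set ℓs) : Set (c ⊔ ℓ ⊔ ℓ' ⊔ ℓs) where
    field
      P1  : ∀ A A' → A ⊇ A' → S A' → S A
      P2' : ∀ A u → S (A ,, [ u ]) → S (A -ₛ u) → S A
      P3  : ∀ a → a ≤ ε → S [ a ]

  record IsRegular {ℓs : Level} (S : FinSub → Set ℓs) : Set (c ⊔ ℓ ⊔ ℓ' ⊔ ℓs) where
    field
      isEquivariant : IsEquivariant S
      P2 : ∀ A B → S ((A ⊕ B) ,, A) → S ((A ⊕ B) ,, B) → S (A ⊕ B)
      P5 : ∀ x → S ([ x ] ,, [ x ⁻¹ ])

  -- T_x(S): the least equivariant system of ideals containing S with T_x(S)(x),
  -- given as the inductively generated closure.
  data T {ℓs : Level} (x : Carrier) (S : FinSub → Set ℓs) : FinSub → Set (c ⊔ ℓ ⊔ ℓ' ⊔ ℓs) where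
    base : ∀ {A} → S A → T x S A
    gen  : T x S [ x ]
    p1   : ∀ {A A'} → A ⊇ A' → T x S A' → T x S A
    p2'  : ∀ {A u} → T x S (A ,, [ u ]) → T x S (A -ₛ u) → T x S A
    p3   : ∀ {a} → a ≤ ε → T x S [ a ]

  U : {ℓs : Level} → Carrier → (FinSub → Set ℓs) → FinSub → Set (c ⊔ ℓ ⊔ ℓ' ⊔ ℓs)
  U x S A = T x S A × T (x ⁻¹) S A

-- In an equivariant system Q, Q(D, K) together with Q(D - k) for every k ∈ K
-- gives Q(D) (repeated P2').  In T_x(S) each D - k with k = d - x contains x,
-- so T_x(S)(D, D - x) already gives T_x(S)(D); likewise for T_{-x}(S) and
-- D + x.  Hence U_x(S) = S means that S(D, D - x) and S(D, D + x) give S(D).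
-- P5 is immediate, and for P2 one enlarges C = A + B by the translates C + a,
-- a ∈ A, one at a time: each enlargement is undone by this splitting, since
-- S(C, B) makes every D ⊇ C satisfy S(D, D - a); and once all translates are
-- present, cutting away A (using S(C, A)) finishes, because then D - a ⊇ C, B.
module Submission where

open import Defs
open import Level using (Level; _⊔_)
open import Function using (id)
open import Data.Product using (_×_; _,_; proj₁; ∃)
open import Data.Sum using (_⊎_; inj₁; inj₂) renaming ([_,_] to either)
open import Data.List using ([]; _∷_)
open import Data.List.Properties using (++-identityʳ; ++-assoc)
open import Data.List.NonEmpty as L⁺ using ([_]; toList; _⁺++_)
open import Data.List.Relation.Unary.Any as Any using (here; there)
import Data.List.Relation.Unary.Any.Properties as Anyₚ
import Data.List.Membership.Setoid as Membership
open import Data.List.Membership.Setoid.Properties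
  using (∈-resp-≈; ∈-map⁺; ∈-map⁻; ∈-++⁺ˡ; ∈-++⁺ʳ; ∈-++⁻; ∈-concat⁺)
import Data.List.Relation.Binary.Subset.Setoid as Subset
open import Data.List.Relation.Binary.Subset.Setoid.Properties using (⊆-reflexive; map⁺)
import Data.List.Relation.Binary.Equality.Setoid as Equality
import Relation.Binary.PropositionalEquality as ≡
import Algebra.Properties.AbelianGroup as AbelianGroupProperties
import Relation.Binary.Reasoning.Setoid as SetoidReasoning

module _ {c ℓ ℓ' : Level} (𝔾 : PreorderedAbelianGroup c ℓ ℓ') where
  open PreorderedAbelianGroup 𝔾
  open Ideals 𝔾
  open AbelianGroupProperties abGroup using (xyx⁻¹≈y; ⁻¹-involutive; ⁻¹-anti-homo‿-; //-rightDividesʳ)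
  open Membership setoid using () renaming (_∈_ to _∈ₗ_)
  open Subset setoid using (_⊆_)
  open Equality setoid using (≋-reflexive)

  private
    variable
      x y a : Carrier
      A B C D : FinSub

  x∙[x-y]⁻¹≈y : ∀ x y → x ∙ (x - y) ⁻¹ ≈ y
  x∙[x-y]⁻¹≈y x y = begin
    x ∙ (x - y) ⁻¹  ≈⟨ ∙-congˡ (⁻¹-anti-homo‿- x y) ⟩
    x ∙ (y - x)     ≈⟨ assoc x y (x ⁻¹) ⟨
    x ∙ y ∙ x ⁻¹    ≈⟨ xyx⁻¹≈y x y ⟩
    y               ∎
    where open SetoidReasoning setoid

  ⊇-trans : A ⊇ B → B ⊇ C → A ⊇ C
  ⊇-trans A⊇B B⊇C x∈C = A⊇B (B⊇C x∈C)

  ,,-⊇ˡ : (A ,, B) ⊇ A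
  ,,-⊇ˡ = ∈-++⁺ˡ setoid

  ,,-⊇ʳ : (A ,, B) ⊇ B
  ,,-⊇ʳ {A = A} = ∈-++⁺ʳ setoid (toList A)

  ,,-least : D ⊇ A → D ⊇ B → D ⊇ (A ,, B)
  ,,-least {A = A} D⊇A D⊇B x∈A,B = either D⊇A D⊇B (∈-++⁻ setoid (toList A) x∈A,B)

  ∈⇒⊇[] : x ∈ A → A ⊇ [ x ]
  ∈⇒⊇[] x∈A (here y≈x) = ∈-resp-≈ setoid (sym y≈x) x∈A

  ∈-+ₛ⁺ : a ∈ A → (a ∙ x) ∈ (A +ₛ x)
  ∈-+ₛ⁺ = ∈-map⁺ setoid setoid ∙-congʳ

  ∈-+ₛ⁻ : y ∈ (A +ₛ x) → ∃ λ a → a ∈ A × y ≈ a ∙ x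
  ∈-+ₛ⁻ = ∈-map⁻ setoid setoid

  +ₛ-mono : A ⊇ B → (A +ₛ x) ⊇ (B +ₛ x)
  +ₛ-mono = map⁺ setoid setoid ∙-congʳ

  +ₛ-cong : x ≈ y → (A +ₛ y) ⊇ (A +ₛ x)
  +ₛ-cong x≈y z∈A+x with ∈-+ₛ⁻ z∈A+x
  ... | a , a∈A , z≈a+x = ∈-resp-≈ setoid (sym (trans z≈a+x (∙-congˡ x≈y))) (∈-+ₛ⁺ a∈A)

  ⊇+ₛ⇒-ₛ⊇ : D ⊇ (C +ₛ a) → (D -ₛ a) ⊇ C
  ⊇+ₛ⇒-ₛ⊇ {a = a} D⊇C+a {c} c∈C =
    ∈-resp-≈ setoid (//-rightDividesʳ a c) (∈-+ₛ⁺ (D⊇C+a (∈-+ₛ⁺ c∈C)))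

  ∈-⊕⁺ : a ∈ A → y ∈ B → (a ∙ y) ∈ (A ⊕ B)
  ∈-⊕⁺ {B = B} a∈A y∈B =
    ∈-concat⁺ setoid
      (Anyₚ.map⁺ {f = toList} (Anyₚ.map⁺ {f = λ a → L⁺.map (a ∙_) B} (Any.map a∙y∈a+B a∈A)))
    where
    a∙y∈a+B : ∀ {a a′} → a ≈ a′ → _ ∈ L⁺.map (a′ ∙_) B
    a∙y∈a+B a≈a′ = ∈-resp-≈ setoid (∙-congʳ (sym a≈a′)) (∈-map⁺ setoid setoid ∙-congˡ y∈B)

  ⊕-ₛ⊇ : a ∈ A → ((A ⊕ B) -ₛ a) ⊇ B
  ⊕-ₛ⊇ {a = a} a∈A {b} b∈B = ∈-resp-≈ setoid (xyx⁻¹≈y a b) (∈-+ₛ⁺ (∈-⊕⁺ a∈A b∈B))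

  module _ {ℓq : Level} {Q : FinSub → Set ℓq} (Q-equivariant : IsEquivariant Q) where
    open IsEquivariant Q-equivariant

    cut : ∀ D K → (∀ {k} → k ∈ K → Q (D -ₛ k)) → Q (D ,, K) → Q D
    cut D K = cut-list (toList K) D
      where
      -- D ,, K is definitionally D ⁺++ toList K.
      cut-list : ∀ K D → (∀ {k} → k ∈ₗ K → Q (D -ₛ k)) → Q (D ⁺++ K) → Q D
      cut-list [] D _ Q[D++[]] =
        P1 D (D ⁺++ []) (⊆-reflexive setoid (≋-reflexive (++-identityʳ (toList D)))) Q[D++[]]
      cut-list (k ∷ K) D Q[D-K] Q[D++k∷K] = P2' D k Q[D,k] (Q[D-K] (here refl))
        where
        Q[D,k] : Q (D ,, [ k ])
        Q[D,k] = cut-list K (D ,, [ k ])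
          (λ k′∈K → P1 _ _ (+ₛ-mono ,,-⊇ˡ) (Q[D-K] (there k′∈K)))
          (P1 _ _ (⊆-reflexive setoid (≋-reflexive (≡.sym (++-assoc (toList D) (k ∷ []) K)))) Q[D++k∷K])

  module _ {ℓs : Level} {S : FinSub → Set ℓs} where

    T-isEquivariant : IsEquivariant (T x S)
    T-isEquivariant = record { P1 = λ _ _ → p1 ; P2' = λ _ _ → p2' ; P3 = λ _ → p3 }

    T-cut-shift : T x S (D ,, (D -ₛ x)) → T x S D
    T-cut-shift {x = x} {D = D} = cut T-isEquivariant D (D -ₛ x) T[D-k]
      where
      T[D-k] : ∀ {k} → k ∈ (D -ₛ x) → T x S (D -ₛ k)
      T[D-k] {k} k∈D-x with ∈-+ₛ⁻ k∈D-x
      ... | d , d∈D , k≈d-x = p1 (∈⇒⊇[] (∈-resp-≈ setoid d-k≈x (∈-+ₛ⁺ d∈D))) gen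
        where
        d-k≈x : d - k ≈ x
        d-k≈x = trans (∙-congˡ (⁻¹-cong k≈d-x)) (x∙[x-y]⁻¹≈y d x)

  SplitsShifts : {ℓs : Level} → (FinSub → Set ℓs) → Set (c ⊔ ℓs)
  SplitsShifts S = ∀ x D → S (D ,, (D -ₛ x)) → S (D ,, (D +ₛ x)) → S D

  module _ {ℓs : Level} {S : FinSub → Set ℓs} (U⊆S : ∀ {x A} → U x S A → S A) where

    U⊆S⇒splitsShifts : SplitsShifts S
    U⊆S⇒splitsShifts x D S[D,D-x] S[D,D+x] =
      U⊆S (T-cut-shift (base S[D,D-x]) , T-cut-shift T[D,D-x⁻¹])
      where
      T[D,D-x⁻¹] : T (x ⁻¹) S (D ,, (D -ₛ (x ⁻¹)))
      T[D,D-x⁻¹] = p1 (,,-least ,,-⊇ˡ (⊇-trans ,,-⊇ʳ (+ₛ-cong (sym (⁻¹-involutive x))))) (base S[D,D+x])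

    U⊆S⇒P5 : ∀ x → S ([ x ] ,, [ x ⁻¹ ])
    U⊆S⇒P5 x = U⊆S (p1 ,,-⊇ˡ gen , p1 (,,-⊇ʳ {A = [ x ]}) gen)

  module _ {ℓs : Level} {S : FinSub → Set ℓs} (S-equivariant : IsEquivariant S)
           (splits : SplitsShifts S) (A B : FinSub)
           (S[C,A] : S ((A ⊕ B) ,, A)) (S[C,B] : S ((A ⊕ B) ,, B)) where
    open IsEquivariant S-equivariant

    S-shift-down : D ⊇ (A ⊕ B) → a ∈ A → S (D ,, (D -ₛ a))
    S-shift-down D⊇C a∈A =
      P1 _ _ (,,-least (⊇-trans ,,-⊇ˡ D⊇C) (⊇-trans ,,-⊇ʳ (⊇-trans (+ₛ-mono D⊇C) (⊕-ₛ⊇ a∈A)))) S[C,B]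

    S-translates-closed : D ⊇ (A ⊕ B) → (∀ {a} → a ∈ A → D ⊇ ((A ⊕ B) +ₛ a)) → S D
    S-translates-closed {D} D⊇C D⊇C+A = cut S-equivariant D A S[D-a] S[D,A]
      where
      S[D,A] : S (D ,, A)
      S[D,A] = P1 _ _ (,,-least (⊇-trans ,,-⊇ˡ D⊇C) ,,-⊇ʳ) S[C,A]
      S[D-a] : ∀ {a} → a ∈ A → S (D -ₛ a)
      S[D-a] a∈A = P1 _ _ (,,-least (⊇+ₛ⇒-ₛ⊇ (D⊇C+A a∈A)) (⊇-trans (+ₛ-mono D⊇C) (⊕-ₛ⊇ a∈A))) S[C,B]

    S-add-translates : ∀ L → L ⊆ toList A → D ⊇ (A ⊕ B) →
                       (∀ {a} → a ∈ A → a ∈ₗ L ⊎ D ⊇ ((A ⊕ B) +ₛ a)) → S D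
    S-add-translates [] _ D⊇C pending = S-translates-closed D⊇C λ a∈A → done (pending a∈A)
      where
      done : a ∈ₗ [] ⊎ D ⊇ ((A ⊕ B) +ₛ a) → D ⊇ ((A ⊕ B) +ₛ a)
      done (inj₂ D⊇C+a) = D⊇C+a
    S-add-translates {D} (x ∷ L) L⊆A D⊇C pending =
      splits x D (S-shift-down D⊇C (L⊆A (here refl)))
        (S-add-translates L (λ a∈L → L⊆A (there a∈L)) (⊇-trans ,,-⊇ˡ D⊇C) pending′)
      where
      pending′ : a ∈ A → a ∈ₗ L ⊎ (D ,, (D +ₛ x)) ⊇ ((A ⊕ B) +ₛ a)
      pending′ a∈A with pending a∈A
      ... | inj₁ (here a≈x)  = inj₂ (⊇-trans ,,-⊇ʳ (⊇-trans (+ₛ-mono D⊇C) (+ₛ-cong a≈x)))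
      ... | inj₁ (there a∈L) = inj₁ a∈L
      ... | inj₂ D⊇C+a       = inj₂ (⊇-trans ,,-⊇ˡ D⊇C+a)

    splitsShifts⇒P2 : S (A ⊕ B)
    splitsShifts⇒P2 = S-add-translates (toList A) id id inj₁

lemma4p4 : {c ℓ ℓ' ℓs : Level} (𝔾 : PreorderedAbelianGroup c ℓ ℓ') →
    let open Ideals 𝔾 in
    (S : FinSub → Set ℓs) → IsEquivariant S →
    (∀ x A → (U x S A → S A) × (S A → U x S A)) →
    IsRegular S
lemma4p4 𝔾 S S-equivariant U≡S = record
  { isEquivariant = S-equivariant
  ; P2 = splitsShifts⇒P2 𝔾 S-equivariant (U⊆S⇒splitsShifts 𝔾 U⊆S)
  ; P5 = U⊆S⇒P5 𝔾 U⊆S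
  }
  where
  U⊆S : ∀ {x A} → Ideals.U 𝔾 x S A → S A
  U⊆S {x} {A} = proj₁ (U≡S x A)
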